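{- Let $p$ be an odd prime with $p \equiv 7 \pmod{40}$ or $p \equiv 23 \pmod{40}$. Then the elliptic curve $E_p : y^2 = x^3 - 5px$ has rank zero over $\mathbb{Q}$, i.e. the Mordell–Weil group $E_p(\mathbb{Q})$ is finite.
   Context: The rank of an elliptic curve $E$ over a field $K$ is the rank $r$ of the finitely generated abelian group $E(K) \cong \mathbb{Z}^r \oplus E(K)_{\mathrm{tors}}$. -}

module Defs where

open import Data.Nat using (ℕ)
open import Data.Rational using (ℚ; _*_; _-_; _/_)
open import Data.Integer using (+_)
open import Data.Product using (_×_; _,_; ∃)
open import Data.List using (List)
open import Data.List.Membership.Propositional using (_∈_)
open import Relation.Binary.PropositionalEquality using (_≡_)

5p : ℕ → ℚ
5p p = (+ (5 Data.Nat.* p)) / 1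

OnCurve : ℕ → ℚ → ℚ → Set
OnCurve p x y = y * y ≡ x * x * x - 5p p * x

data Point (p : ℕ) : Set where
  ∞ : Point p
  affine : (x y : ℚ) → OnCurve p x y → Point p

-- E_p(ℚ) is finite: its affine part is contained in some finite list
-- (the remaining point, ∞, is a single extra point).
FiniteMW : ℕ → Set
FiniteMW p = ∃ λ (L : List (ℚ × ℚ)) → ∀ x y → OnCurve p x y → (x , y) ∈ L

-- E(ℚ) = {∞, (0, 0)}. Write x = ±A/e² and y = C/e³ in lowest terms. Then
-- C² = A |A² - 5p e⁴|, and gcd (A, |A² - 5p e⁴|) divides 5p, so A = g M² with g ∣ 5p:
-- a nonzero point gives a primitive solution (n ≠ 0) of a quartic w² + d₂ n⁴ = d₁ m⁴
-- with d₁ d₂ = 5p, one of the 2-coverings of E. Congruences modulo 8 (5p ≡ 3) and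
-- modulo 5 (p is a quadratic non-residue) exclude all of them except w² + 5p n⁴ = m⁴.
-- A solution of that one yields, through the covering M² = 20p s⁴ + r⁴ of the
-- 2-isogenous curve y² = x³ + 20p x, another solution with 0 < n′ < n: infinite descent.

module Submission where

open import Defs
open import Data.Nat using (ℕ; _%_)
open import Data.Nat.Primality using (Prime)
open import Data.Sum using (_⊎_)
open import Relation.Binary.PropositionalEquality using (_≡_)

import Data.Nat as ℕ
import Data.Nat.Properties as ℕ
open import Data.Nat.Coprimality as Coprimality using (Coprime; coprime-divisor; 1-coprimeTo)
open import Data.Nat.Primality
import Data.Nat.Solver as ℕ-Solver
open import Data.Integer as ℤ using (ℤ; +_; -[1+_]; ∣_∣)
import Data.Integer.Properties as ℤ
import Data.Integer.Solver as ℤ-Solver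
open import Data.Rational as ℚ using (ℚ; mkℚ; 0ℚ; toℚᵘ; ↥_; ↧_; ↧ₙ_)
import Data.Rational.Properties as ℚ
open import Data.Rational.Unnormalised as ℚᵘ using (mkℚᵘ; *≡*)
import Data.Rational.Unnormalised.Properties as ℚᵘ
open import Data.Product using (∃; ∃₂; ∃-syntax; _×_; _,_; proj₁; proj₂)
open import Data.Sum as Sum using (_⊎_; inj₁; inj₂; [_,_]′)
open import Data.Empty using (⊥-elim)
open import Data.List using (List; []; _∷_; map; upTo)
open import Data.List.Membership.Propositional using (_∈_)
open import Data.List.Membership.Propositional.Properties using (∈-map⁺; ∈-upTo⁺)
open import Data.List.Relation.Unary.All using (All; all?; lookup)
open import Data.List.Relation.Unary.Any using (here; there)
open import Function using (id; _∘_; case_of_)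
open import Relation.Nullary
open import Relation.Nullary.Decidable using (from-yes; ¬?; _→-dec_)
open import Relation.Binary.PropositionalEquality
open import Relation.Binary.Definitions using (tri<; tri≈; tri>)

-- From rational points to integer equations

module _ (p : ℕ) where

  open import Data.Integer using (_+_; _*_; _^_; -_)

  5p≡mkℚ : 5p p ≡ mkℚ (+ (5 ℕ.* p)) 0 (Coprimality.sym (1-coprimeTo (5 ℕ.* p)))
  5p≡mkℚ = ℚ.normalize-coprime _

  onCurve⇒≃ᵘ : ∀ {x y} → OnCurve p x y →
    toℚᵘ y ℚᵘ.* toℚᵘ y ℚᵘ.≃ toℚᵘ x ℚᵘ.* toℚᵘ x ℚᵘ.* toℚᵘ x ℚᵘ.- mkℚᵘ (+ (5 ℕ.* p)) 0 ℚᵘ.* toℚᵘ x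
  onCurve⇒≃ᵘ {x} {y} oc = begin
    toℚᵘ y ℚᵘ.* toℚᵘ y                                ≈⟨ ℚ.toℚᵘ-homo-* y y ⟨
    toℚᵘ (y ℚ.* y)                                    ≡⟨ cong toℚᵘ oc ⟩
    toℚᵘ (x ℚ.* x ℚ.* x ℚ.- 5p p ℚ.* x)               ≈⟨ ℚ.toℚᵘ-homo-+ (x ℚ.* x ℚ.* x) (ℚ.- (5p p ℚ.* x)) ⟩
    toℚᵘ (x ℚ.* x ℚ.* x) ℚᵘ.+ toℚᵘ (ℚ.- (5p p ℚ.* x)) ≈⟨ ℚᵘ.+-cong cube negation ⟩
    toℚᵘ x ℚᵘ.* toℚᵘ x ℚᵘ.* toℚᵘ x ℚᵘ.- mkℚᵘ (+ (5 ℕ.* p)) 0 ℚᵘ.* toℚᵘ x ∎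
    where
    open ℚᵘ.≃-Reasoning
    cube : toℚᵘ (x ℚ.* x ℚ.* x) ℚᵘ.≃ toℚᵘ x ℚᵘ.* toℚᵘ x ℚᵘ.* toℚᵘ x
    cube = ℚᵘ.≃-trans (ℚ.toℚᵘ-homo-* (x ℚ.* x) x) (ℚᵘ.*-cong (ℚ.toℚᵘ-homo-* x x) ℚᵘ.≃-refl)
    negation : toℚᵘ (ℚ.- (5p p ℚ.* x)) ℚᵘ.≃ ℚᵘ.- (mkℚᵘ (+ (5 ℕ.* p)) 0 ℚᵘ.* toℚᵘ x)
    negation = ℚᵘ.≃-trans (ℚ.toℚᵘ-homo‿- (5p p ℚ.* x)) (ℚᵘ.-‿cong (ℚᵘ.≃-trans (ℚ.toℚᵘ-homo-* (5p p) x)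
                 (ℚᵘ.*-cong (ℚᵘ.≃-reflexive (cong toℚᵘ 5p≡mkℚ)) ℚᵘ.≃-refl)))

  curve-equation-ℤ : ∀ x y → OnCurve p x y →
    ↥ y ^ 2 * ↧ x ^ 3 + + (5 ℕ.* p) * ↥ x * ↧ x ^ 2 * ↧ y ^ 2 ≡ ↥ x ^ 3 * ↧ y ^ 2
  -- matching on the records lets toℚᵘ x and toℚᵘ y compute
  curve-equation-ℤ x@record{} y@record{} oc with *≡* cross-multiplied ← onCurve⇒≃ᵘ {x} {y} oc =
    ℤ.*-cancelˡ-≡ B _ _ (begin
      B * (c ^ 2 * B ^ 3 + P * a * B ^ 2 * D ^ 2)
        ≡⟨ solve 5 (λ B c P a D → B :* (c :^ 2 :* B :^ 3 :+ P :* a :* B :^ 2 :* D :^ 2)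
                               := c :* c :* (B :* B :* B :* B) :+ P :* a :* (B :* B :* B) :* (D :* D))
                 refl B c P a D ⟩
      c * c * (B * B * B * B) + P * a * (B * B * B) * (D * D)
        ≡⟨ cong (λ t → t + P * a * (B * B * B) * (D * D)) cleared ⟩
      (a * a * a * B + - (P * a) * (B * B * B)) * (D * D) + P * a * (B * B * B) * (D * D)
        ≡⟨ solve 4 (λ a B P D → (a :* a :* a :* B :+ :- (P :* a) :* (B :* B :* B)) :* (D :* D)
                                 :+ P :* a :* (B :* B :* B) :* (D :* D)
                               := B :* (a :^ 3 :* D :^ 2))
                 refl a B P D ⟩
      B * (a ^ 3 * D ^ 2) ∎)
    where
    open ≡-Reasoning
    open ℤ-Solver.+-*-Solver
    a c B D P : ℤ
    a = ↥ x
    c = ↥ y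
    B = ↧ x
    D = ↧ y
    P = + (5 ℕ.* p)
    +b³≡B³ : + (↧ₙ x ℕ.* ↧ₙ x ℕ.* ↧ₙ x) ≡ B * B * B
    +b³≡B³ = trans (ℤ.pos-* (↧ₙ x ℕ.* ↧ₙ x) (↧ₙ x)) (cong (_* B) (ℤ.pos-* (↧ₙ x) (↧ₙ x)))
    +1*b≡B : + (1 ℕ.* ↧ₙ x) ≡ B
    +1*b≡B = cong +_ (ℕ.*-identityˡ (↧ₙ x))
    cleared : c * c * (B * B * B * B) ≡ (a * a * a * B + - (P * a) * (B * B * B)) * (D * D)
    cleared = begin
      c * c * (B * B * B * B)
        ≡⟨ cong (c * c *_) (trans (ℤ.pos-* (↧ₙ x ℕ.* ↧ₙ x ℕ.* ↧ₙ x) (1 ℕ.* ↧ₙ x))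
                                  (cong₂ _*_ +b³≡B³ +1*b≡B)) ⟨
      c * c * + (↧ₙ x ℕ.* ↧ₙ x ℕ.* ↧ₙ x ℕ.* (1 ℕ.* ↧ₙ x))
        ≡⟨ cross-multiplied ⟩
      (a * a * a * + (1 ℕ.* ↧ₙ x) + - (P * a) * + (↧ₙ x ℕ.* ↧ₙ x ℕ.* ↧ₙ x)) * + (↧ₙ y ℕ.* ↧ₙ y)
        ≡⟨ cong₂ (λ s t → (a * a * a * s + - (P * a) * t) * + (↧ₙ y ℕ.* ↧ₙ y)) +1*b≡B +b³≡B³ ⟩
      (a * a * a * B + - (P * a) * (B * B * B)) * + (↧ₙ y ℕ.* ↧ₙ y)
        ≡⟨ cong ((a * a * a * B + - (P * a) * (B * B * B)) *_) (ℤ.pos-* (↧ₙ y) (↧ₙ y)) ⟩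
      (a * a * a * B + - (P * a) * (B * B * B)) * (D * D) ∎

-- The arithmetic of ℕ is opened only from here on: the block above uses that of ℤ.
open import Data.Nat
open import Data.Nat.Properties
open import Data.Nat.DivMod
open import Data.Nat.Divisibility
open import Data.Nat.GCD
open import Data.Nat.Induction using (<-rec)

pos-^ : ∀ m k → + (m ^ k) ≡ (+ m) ℤ.^ k
pos-^ m zero    = refl
pos-^ m (suc k) = trans (ℤ.pos-* m (m ^ k)) (cong (+ m ℤ.*_) (pos-^ m k))

pos-∣∣^2 : ∀ c → + (∣ c ∣ ^ 2) ≡ c ℤ.^ 2
pos-∣∣^2 (+ n)    = pos-^ n 2
pos-∣∣^2 -[1+ n ] = trans (pos-^ (suc n) 2) (solve 1 (λ x → x :^ 2 := (:- x) :^ 2) refl (+ suc n))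
  where open ℤ-Solver.+-*-Solver

module _ (k A : ℕ) (c : ℤ) (b d : ℕ) where

  private
    +c²b³ : + (∣ c ∣ ^ 2 * b ^ 3) ≡ c ℤ.^ 2 ℤ.* (+ b) ℤ.^ 3
    +c²b³ = trans (ℤ.pos-* (∣ c ∣ ^ 2) (b ^ 3)) (cong₂ ℤ._*_ (pos-∣∣^2 c) (pos-^ b 3))
    +kAb²d² : + (k * A * b ^ 2 * d ^ 2) ≡ + k ℤ.* + A ℤ.* (+ b) ℤ.^ 2 ℤ.* (+ d) ℤ.^ 2
    +kAb²d² = trans (ℤ.pos-* (k * A * b ^ 2) (d ^ 2)) (cong₂ ℤ._*_
                (trans (ℤ.pos-* (k * A) (b ^ 2)) (cong₂ ℤ._*_ (ℤ.pos-* k A) (pos-^ b 2))) (pos-^ d 2))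
    +A³d² : + (A ^ 3 * d ^ 2) ≡ (+ A) ℤ.^ 3 ℤ.* (+ d) ℤ.^ 2
    +A³d² = trans (ℤ.pos-* (A ^ 3) (d ^ 2)) (cong₂ ℤ._*_ (pos-^ A 3) (pos-^ d 2))

  curve-equation-ℕ⁺ :
    c ℤ.^ 2 ℤ.* (+ b) ℤ.^ 3 ℤ.+ + k ℤ.* + A ℤ.* (+ b) ℤ.^ 2 ℤ.* (+ d) ℤ.^ 2 ≡ (+ A) ℤ.^ 3 ℤ.* (+ d) ℤ.^ 2 →
    ∣ c ∣ ^ 2 * b ^ 3 + k * A * b ^ 2 * d ^ 2 ≡ A ^ 3 * d ^ 2
  curve-equation-ℕ⁺ eq = ℤ.+-injective (begin
    + (∣ c ∣ ^ 2 * b ^ 3 + k * A * b ^ 2 * d ^ 2)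
      ≡⟨ ℤ.pos-+ (∣ c ∣ ^ 2 * b ^ 3) _ ⟩
    + (∣ c ∣ ^ 2 * b ^ 3) ℤ.+ + (k * A * b ^ 2 * d ^ 2)
      ≡⟨ cong₂ ℤ._+_ +c²b³ +kAb²d² ⟩
    c ℤ.^ 2 ℤ.* (+ b) ℤ.^ 3 ℤ.+ + k ℤ.* + A ℤ.* (+ b) ℤ.^ 2 ℤ.* (+ d) ℤ.^ 2
      ≡⟨ eq ⟩
    (+ A) ℤ.^ 3 ℤ.* (+ d) ℤ.^ 2
      ≡⟨ +A³d² ⟨
    + (A ^ 3 * d ^ 2) ∎)
    where open ≡-Reasoning

  curve-equation-ℕ⁻ :
    c ℤ.^ 2 ℤ.* (+ b) ℤ.^ 3 ℤ.+ + k ℤ.* ℤ.- (+ A) ℤ.* (+ b) ℤ.^ 2 ℤ.* (+ d) ℤ.^ 2 ≡ (ℤ.- (+ A)) ℤ.^ 3 ℤ.* (+ d) ℤ.^ 2 →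
    ∣ c ∣ ^ 2 * b ^ 3 + A ^ 3 * d ^ 2 ≡ k * A * b ^ 2 * d ^ 2
  curve-equation-ℕ⁻ eq = ℤ.+-injective (begin
    + (∣ c ∣ ^ 2 * b ^ 3 + A ^ 3 * d ^ 2)
      ≡⟨ ℤ.pos-+ (∣ c ∣ ^ 2 * b ^ 3) _ ⟩
    + (∣ c ∣ ^ 2 * b ^ 3) ℤ.+ + (A ^ 3 * d ^ 2)
      ≡⟨ cong₂ ℤ._+_ +c²b³ +A³d² ⟩
    c ℤ.^ 2 ℤ.* (+ b) ℤ.^ 3 ℤ.+ (+ A) ℤ.^ 3 ℤ.* (+ d) ℤ.^ 2
      ≡⟨ solve 5 (λ c B K A D → c :^ 2 :* B :^ 3 :+ A :^ 3 :* D :^ 2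
                              := (c :^ 2 :* B :^ 3 :+ K :* (:- A) :* B :^ 2 :* D :^ 2)
                                 :+ (K :* A :* B :^ 2 :* D :^ 2 :+ A :^ 3 :* D :^ 2))
                 refl c (+ b) (+ k) (+ A) (+ d) ⟩
    (c ℤ.^ 2 ℤ.* (+ b) ℤ.^ 3 ℤ.+ + k ℤ.* ℤ.- (+ A) ℤ.* (+ b) ℤ.^ 2 ℤ.* (+ d) ℤ.^ 2) ℤ.+ kAb²d²+A³d²
      ≡⟨ cong (ℤ._+ kAb²d²+A³d²) eq ⟩
    (ℤ.- (+ A)) ℤ.^ 3 ℤ.* (+ d) ℤ.^ 2 ℤ.+ kAb²d²+A³d²
      ≡⟨ solve 4 (λ A D K B → (:- A) :^ 3 :* D :^ 2 :+ (K :* A :* B :^ 2 :* D :^ 2 :+ A :^ 3 :* D :^ 2)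
                              := K :* A :* B :^ 2 :* D :^ 2)
                 refl (+ A) (+ d) (+ k) (+ b) ⟩
    + k ℤ.* + A ℤ.* (+ b) ℤ.^ 2 ℤ.* (+ d) ℤ.^ 2
      ≡⟨ +kAb²d² ⟨
    + (k * A * b ^ 2 * d ^ 2) ∎)
    where
    open ≡-Reasoning
    open ℤ-Solver.+-*-Solver
    kAb²d²+A³d² : ℤ
    kAb²d²+A³d² = + k ℤ.* + A ℤ.* (+ b) ℤ.^ 2 ℤ.* (+ d) ℤ.^ 2 ℤ.+ (+ A) ℤ.^ 3 ℤ.* (+ d) ℤ.^ 2

open ℕ-Solver.+-*-Solver

private
  variable
    a b c d d₁ d₂ e f k m n o q r s t u v w x y A C M : ℕ

-- Powers, coprimality and squares in ℕ

m^2≡m*m : ∀ m → m ^ 2 ≡ m * m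
m^2≡m*m m = cong (m *_) (*-identityʳ m)

m^n≡o^n⇒m≡o : ∀ n .{{_ : NonZero n}} → m ^ n ≡ o ^ n → m ≡ o
m^n≡o^n⇒m≡o {m} {o} n eq with <-cmp m o
... | tri< m<o _ _ = contradiction eq (<⇒≢ (^-monoˡ-< n m<o))
... | tri≈ _ m≡o _ = m≡o
... | tri> _ _ o<m = contradiction (sym eq) (<⇒≢ (^-monoˡ-< n o<m))

m^n≤o^n⇒m≤o : ∀ n .{{_ : NonZero n}} → m ^ n ≤ o ^ n → m ≤ o
m^n≤o^n⇒m≤o n le = ≮⇒≥ λ o<m → <⇒≱ (^-monoˡ-< n o<m) le

^-distribʳ-* : ∀ k m n → (m * n) ^ k ≡ m ^ k * n ^ k
^-distribʳ-* zero    m n = refl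
^-distribʳ-* (suc k) m n = begin
  m * n * (m * n) ^ k        ≡⟨ cong (m * n *_) (^-distribʳ-* k m n) ⟩
  m * n * (m ^ k * n ^ k)    ≡⟨ [m*n]*[o*p]≡[m*o]*[n*p] m n (m ^ k) (n ^ k) ⟩
  m * m ^ k * (n * n ^ k)    ∎
  where open ≡-Reasoning

^-monoˡ-∣ : ∀ k → d ∣ m → d ^ k ∣ m ^ k
^-monoˡ-∣ zero    _   = ∣-refl
^-monoˡ-∣ (suc k) d∣m = *-pres-∣ d∣m (^-monoˡ-∣ k d∣m)

∣⇒∣^ : ∀ k .{{_ : NonZero k}} → d ∣ m → d ∣ m ^ k
∣⇒∣^ {m = m} (suc k) d∣m = ∣m⇒∣m*n (m ^ k) d∣m

prime∣^⇒∣ : ∀ k .{{_ : NonZero k}} → Prime q → q ∣ m ^ k → q ∣ m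
prime∣^⇒∣ {m = m} 1 _ q∣m^1 = subst (_ ∣_) (*-identityʳ m) q∣m^1
prime∣^⇒∣ {m = m} (suc k@(suc _)) q-prime q∣m^k =
  [ id , prime∣^⇒∣ k q-prime ]′ (euclidsLemma m (m ^ k) q-prime q∣m^k)

coprime-∣ˡ : d ∣ m → Coprime m n → Coprime d n
coprime-∣ˡ d∣m m⊥n (i∣d , i∣n) = m⊥n (∣-trans i∣d d∣m , i∣n)

coprime-∣ʳ : d ∣ n → Coprime m n → Coprime m d
coprime-∣ʳ d∣n m⊥n = Coprimality.sym (coprime-∣ˡ d∣n (Coprimality.sym m⊥n))

coprime-*ˡ : Coprime m o → Coprime n o → Coprime (m * n) o
coprime-*ˡ {m} m⊥o n⊥o {i} (i∣mn , i∣o) = n⊥o (coprime-divisor i⊥m i∣mn , i∣o)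
  where
  i⊥m : Coprime i m
  i⊥m (j∣i , j∣m) = m⊥o (j∣m , ∣-trans j∣i i∣o)

coprime-*ʳ : Coprime m n → Coprime m o → Coprime m (n * o)
coprime-*ʳ m⊥n m⊥o = Coprimality.sym (coprime-*ˡ (Coprimality.sym m⊥n) (Coprimality.sym m⊥o))

coprime-^ˡ : ∀ k → Coprime m n → Coprime (m ^ k) n
coprime-^ˡ zero    _   (i∣1 , _) = ∣1⇒≡1 i∣1
coprime-^ˡ (suc k) m⊥n = coprime-*ˡ m⊥n (coprime-^ˡ k m⊥n)

coprime-^ʳ : ∀ k → Coprime m n → Coprime m (n ^ k)
coprime-^ʳ k m⊥n = Coprimality.sym (coprime-^ˡ k (Coprimality.sym m⊥n))

coprime-^ : ∀ j k → Coprime m n → Coprime (m ^ j) (n ^ k)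
coprime-^ j k m⊥n = coprime-^ʳ k (coprime-^ˡ j m⊥n)

coprime-^⁻ : ∀ j k .{{_ : NonZero j}} .{{_ : NonZero k}} → Coprime (m ^ j) (n ^ k) → Coprime m n
coprime-^⁻ j k cop = coprime-∣ˡ (∣⇒∣^ j ∣-refl) (coprime-∣ʳ (∣⇒∣^ k ∣-refl) cop)

¬∣⇒coprime : Prime q → ¬ q ∣ m → Coprime q m
¬∣⇒coprime q-prime q∤m (i∣q , i∣m) with prime⇒irreducible q-prime i∣q
... | inj₁ i≡1  = i≡1
... | inj₂ refl = contradiction i∣m q∤m

prime[5] : Prime 5
prime[5] = from-yes (prime? 5)

-- Writing g = gcd m c, one gets g ^ 2 ∣ m from coprimality and m ∣ g ^ 2 from
-- c * g = gcd (c * m) (m * n).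
coprime∧*≡^2⇒^2 : Coprime m n → m * n ≡ c ^ 2 → ∃ λ a → m ≡ a ^ 2
coprime∧*≡^2⇒^2 {m} {n} {c} m⊥n mn≡c² = g , ∣-antisym m∣g² g²∣m
  where
  g : ℕ
  g = gcd m c
  g²∣m : g ^ 2 ∣ m
  g²∣m = coprime-divisor (coprime-^ˡ 2 (coprime-∣ˡ (gcd[m,n]∣m m c) m⊥n))
           (subst (g ^ 2 ∣_) (trans (sym mn≡c²) (*-comm m n)) (^-monoˡ-∣ 2 (gcd[m,n]∣n m c)))
  m∣c*g : m ∣ c * g
  m∣c*g = subst (m ∣_) (sym (trans (c*gcd[m,n]≡gcd[cm,cn] c m c)
                                   (cong (gcd (c * m)) (trans (sym (m^2≡m*m c)) (sym mn≡c²)))))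
            (gcd-greatest (n∣m*n c) (m∣m*n n))
  m∣g² : m ∣ g ^ 2
  m∣g² = subst (m ∣_) (sym (trans (m^2≡m*m g) (c*gcd[m,n]≡gcd[cm,cn] g m c)))
           (gcd-greatest (n∣m*n g) (subst (m ∣_) (*-comm c g) m∣c*g))

coprime∧*≡^2⇒^2×^2 : Coprime m n → m * n ≡ c ^ 2 →
                     ∃₂ λ a b → m ≡ a ^ 2 × n ≡ b ^ 2 × a * b ≡ c
coprime∧*≡^2⇒^2×^2 {m} {n} {c} m⊥n mn≡c²
  with a , refl ← coprime∧*≡^2⇒^2 {c = c} m⊥n mn≡c²
     | b , refl ← coprime∧*≡^2⇒^2 {c = c} (Coprimality.sym m⊥n) (trans (*-comm n m) mn≡c²)
  = a , b , refl , refl , m^n≡o^n⇒m≡o 2 (trans (^-distribʳ-* 2 a b) mn≡c²)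

coprime∧*≡^4⇒^4×^4 : Coprime m n → m * n ≡ c ^ 4 →
                     ∃₂ λ a b → m ≡ a ^ 4 × n ≡ b ^ 4 × a * b ≡ c
coprime∧*≡^4⇒^4×^4 {m} {n} {c} m⊥n mn≡c⁴
  with x , y , refl , refl , xy≡c²
         ← coprime∧*≡^2⇒^2×^2 {c = c ^ 2} m⊥n (trans mn≡c⁴ (sym (^-*-assoc c 2 2)))
  with a , b , x≡a² , y≡b² , ab≡c ← coprime∧*≡^2⇒^2×^2 {c = c} (coprime-^⁻ {x} {y} 2 2 m⊥n) xy≡c²
  = a , b , trans (cong (_^ 2) x≡a²) (^-*-assoc a 2 2) , trans (cong (_^ 2) y≡b²) (^-*-assoc b 2 2) ,
    ab≡c

^2∣^2⇒∣ : m ^ 2 ∣ n ^ 2 → m ∣ n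
^2∣^2⇒∣ {zero}      {n} 0∣n² = subst (0 ∣_) (sym (m^n≡0⇒m≡0 n 2 (0∣⇒≡0 0∣n²))) ∣-refl
^2∣^2⇒∣ {m@(suc _)} {n} m²∣n² = subst (_∣ n) (sym m≡g) (gcd[m,n]∣n m n)
  where
  g : ℕ
  g = gcd m n
  instance
    g≢0 : NonZero g
    g≢0 = ≢-nonZero (gcd[m,n]≢0 m n (inj₁ λ ()))
  m≡m′*g : m ≡ (m / g) * g
  m≡m′*g = sym (m/n*n≡m (gcd[m,n]∣m m n))
  n≡n′*g : n ≡ (n / g) * g
  n≡n′*g = sym (m/n*n≡m (gcd[m,n]∣n m n))
  instance
    g²≢0 : NonZero (g ^ 2)
    g²≢0 = m^n≢0 g 2
  m′²∣n′² : (m / g) ^ 2 ∣ (n / g) ^ 2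
  m′²∣n′² = *-cancelʳ-∣ (g ^ 2) (subst₂ _∣_
    (trans (cong (_^ 2) m≡m′*g) (^-distribʳ-* 2 (m / g) g))
    (trans (cong (_^ 2) n≡n′*g) (^-distribʳ-* 2 (n / g) g)) m²∣n²)
  m′≡1 : m / g ≡ 1
  m′≡1 = m^n≡o^n⇒m≡o 2 (coprime-^ 2 2 (Coprimality.coprime-/gcd m n) (∣-refl , m′²∣n′²))
  m≡g : m ≡ g
  m≡g = trans m≡m′*g (trans (cong (_* g) m′≡1) (*-identityˡ g))

*≡^2⇒gcd-split : m ≢ 0 → m * n ≡ c ^ 2 →
                 ∃[ g ] ∃[ a ] ∃[ b ] m ≡ g * a ^ 2 × n ≡ g * b ^ 2 × Coprime a b
*≡^2⇒gcd-split {m} {n} {c} m≢0 mn≡c² =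
  let a , b , m′≡a² , n′≡b² , _ =
        coprime∧*≡^2⇒^2×^2 {c = c / g} (Coprimality.coprime-/gcd m n) m′n′≡c′²
  in  g , a , b , trans m≡g*m′ (cong (g *_) m′≡a²) , trans n≡g*n′ (cong (g *_) n′≡b²) ,
      coprime-^⁻ 2 2 (subst₂ Coprime m′≡a² n′≡b² (Coprimality.coprime-/gcd m n))
  where
  g : ℕ
  g = gcd m n
  instance
    g≢0 : NonZero g
    g≢0 = ≢-nonZero (gcd[m,n]≢0 m n (inj₁ m≢0))
    g²≢0 : NonZero (g ^ 2)
    g²≢0 = m^n≢0 g 2
  m≡g*m′ : m ≡ g * (m / g)
  m≡g*m′ = sym (m*[n/m]≡n (gcd[m,n]∣m m n))
  n≡g*n′ : n ≡ g * (n / g)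
  n≡g*n′ = sym (m*[n/m]≡n (gcd[m,n]∣n m n))
  mn≡g²m′n′ : m * n ≡ g ^ 2 * (m / g * (n / g))
  mn≡g²m′n′ = trans (cong₂ _*_ m≡g*m′ n≡g*n′)
    (solve 3 (λ g x y → g :* x :* (g :* y) := g :^ 2 :* (x :* y)) refl g (m / g) (n / g))
  g∣c : g ∣ c
  g∣c = ^2∣^2⇒∣ (subst (g ^ 2 ∣_) (trans (sym mn≡g²m′n′) mn≡c²) (m∣m*n _))
  m′n′≡c′² : m / g * (n / g) ≡ (c / g) ^ 2
  m′n′≡c′² = *-cancelˡ-≡ _ _ (g ^ 2) (begin
    g ^ 2 * (m / g * (n / g)) ≡⟨ mn≡g²m′n′ ⟨
    m * n                     ≡⟨ mn≡c² ⟩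
    c ^ 2                     ≡⟨ cong (_^ 2) (m*[n/m]≡n g∣c) ⟨
    (g * (c / g)) ^ 2         ≡⟨ ^-distribʳ-* 2 g (c / g) ⟩
    g ^ 2 * (c / g) ^ 2       ∎)
    where open ≡-Reasoning

prime∣*⇒split : Prime q → m * n ≡ q * k →
                (∃ λ m′ → m ≡ q * m′ × m′ * n ≡ k) ⊎ (∃ λ n′ → n ≡ q * n′ × m * n′ ≡ k)
prime∣*⇒split {q} {m} {n} {k} q-prime mn≡qk
  with euclidsLemma m n q-prime (subst (q ∣_) (sym mn≡qk) (m∣m*n k))
... | inj₁ q∣m = inj₁ (quotient q∣m , m∣n⇒n≡m*quotient q∣m ,
        *-cancelˡ-≡ _ k q {{prime⇒nonZero q-prime}} (trans (sym (*-assoc q _ n))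
          (trans (cong (_* n) (sym (m∣n⇒n≡m*quotient q∣m))) mn≡qk)))
... | inj₂ q∣n = inj₂ (quotient q∣n , m∣n⇒n≡m*quotient q∣n ,
        *-cancelˡ-≡ _ k q {{prime⇒nonZero q-prime}}
          (trans (solve 3 (λ q m n′ → q :* (m :* n′) := m :* (q :* n′)) refl q m (quotient q∣n))
          (trans (cong (m *_) (sym (m∣n⇒n≡m*quotient q∣n))) mn≡qk)))

-- δ = x ∸ y satisfies δ (2y + δ) = 4t, which forces δ to be even.
halving : x ^ 2 ≡ y ^ 2 + 4 * t → ∃ λ r → x ≡ y + 2 * r × r * (y + r) ≡ t
halving {x} {y} {t} x²≡y²+4t = δ/2 , x≡y+2*δ/2 , *-cancelˡ-≡ _ t 4 (begin
  4 * (δ/2 * (y + δ/2))       ≡⟨ solve 2 (λ y h → con 4 :* (h :* (y :+ h))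
                                               := con 2 :* h :* (con 2 :* y :+ con 2 :* h)) refl y δ/2 ⟩
  2 * δ/2 * (2 * y + 2 * δ/2) ≡⟨ cong (λ e → e * (2 * y + e)) δ≡2*δ/2 ⟨
  δ * (2 * y + δ)             ≡⟨ δ[2y+δ]≡4t ⟩
  4 * t                       ∎)
  where
  open ≡-Reasoning
  y≤x : y ≤ x
  y≤x = m^n≤o^n⇒m≤o 2 (subst (y ^ 2 ≤_) (sym x²≡y²+4t) (m≤m+n (y ^ 2) (4 * t)))
  δ : ℕ
  δ = proj₁ (m≤n⇒∃[o]m+o≡n y≤x)
  y+δ≡x : y + δ ≡ x
  y+δ≡x = proj₂ (m≤n⇒∃[o]m+o≡n y≤x)
  δ[2y+δ]≡4t : δ * (2 * y + δ) ≡ 4 * t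
  δ[2y+δ]≡4t = +-cancelˡ-≡ (y ^ 2) _ _ (begin
    y ^ 2 + δ * (2 * y + δ) ≡⟨ solve 2 (λ y δ → y :^ 2 :+ δ :* (con 2 :* y :+ δ) := (y :+ δ) :^ 2)
                                       refl y δ ⟩
    (y + δ) ^ 2             ≡⟨ cong (_^ 2) y+δ≡x ⟩
    x ^ 2                   ≡⟨ x²≡y²+4t ⟩
    y ^ 2 + 4 * t           ∎)
  2∣δ : 2 ∣ δ
  2∣δ = [ id , (λ 2∣2y+δ → ∣m+n∣m⇒∣n 2∣2y+δ (m∣m*n y)) ]′
          (euclidsLemma δ (2 * y + δ) prime[2]
            (subst (2 ∣_) (sym δ[2y+δ]≡4t) (∣m⇒∣m*n t (divides 2 refl))))
  δ/2 : ℕ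
  δ/2 = quotient 2∣δ
  δ≡2*δ/2 : δ ≡ 2 * δ/2
  δ≡2*δ/2 = m∣n⇒n≡m*quotient 2∣δ
  x≡y+2*δ/2 : x ≡ y + 2 * δ/2
  x≡y+2*δ/2 = trans (sym y+δ≡x) (cong (λ z → y + z) δ≡2*δ/2)

m*n≡o≢0⇒m≢0×m≤o : m * n ≡ o → o ≢ 0 → m ≢ 0 × m ≤ o
m*n≡o≢0⇒m≢0×m≤o {m} {n} mn≡o o≢0 = m≢0 , subst (m ≤_) mn≡o (m≤m*n m n {{≢-nonZero n≢0}})
  where
  m≢0 : m ≢ 0
  m≢0 refl = o≢0 (sym mn≡o)
  n≢0 : n ≢ 0
  n≢0 refl = o≢0 (trans (sym mn≡o) (*-zeroʳ m))

-- Clearing the denominators of a point (±a/b, c/d) in lowest terms on y² = x³ - k x;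
-- the two equations are the two signs of the abscissa.
square-cube-denominators : ∀ k → b ≢ 0 → Coprime a b → Coprime c d →
               c ^ 2 * b ^ 3 + k * a * b ^ 2 * d ^ 2 ≡ a ^ 3 * d ^ 2 ⊎
               c ^ 2 * b ^ 3 + a ^ 3 * d ^ 2 ≡ k * a * b ^ 2 * d ^ 2 →
               ∃ λ e → b ≡ e ^ 2 × d ≡ e ^ 3
square-cube-denominators {b} {a} {c} {d} k b≢0 a⊥b c⊥d eq = j , b≡j² , trans d≡jb (cong (j *_) b≡j²)
  where
  open ≡-Reasoning
  instance
    b²≢0 : NonZero (b ^ 2)
    b²≢0 = m^n≢0 b 2 {{≢-nonZero b≢0}}
  b²∣c²b³ : b ^ 2 ∣ c ^ 2 * b ^ 3
  b²∣c²b³ = ∣n⇒∣m*n (c ^ 2) (divides b (solve 1 (λ b → b :^ 3 := b :* b :^ 2) refl b))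
  b²∣kab²d² : b ^ 2 ∣ k * a * b ^ 2 * d ^ 2
  b²∣kab²d² = ∣m⇒∣m*n (d ^ 2) (n∣m*n (k * a))
  b²∣a³d² : b ^ 2 ∣ a ^ 3 * d ^ 2
  b²∣a³d² = [ (λ pos → subst (b ^ 2 ∣_) pos (∣m∣n⇒∣m+n b²∣c²b³ b²∣kab²d²))
            , (λ neg → ∣m+n∣m⇒∣n (subst (b ^ 2 ∣_) (sym neg) b²∣kab²d²) b²∣c²b³) ]′ eq
  b∣d : b ∣ d
  b∣d = ^2∣^2⇒∣ (coprime-divisor (coprime-^ 2 3 (Coprimality.sym a⊥b)) b²∣a³d²)
  j : ℕ
  j = quotient b∣d
  d≡jb : d ≡ j * b
  d≡jb = m∣n⇒n≡quotient*m b∣d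
  divide-by-b² : ∀ {x y x′ y′} → b ^ 2 * x′ ≡ x → b ^ 2 * y′ ≡ y → x ≡ y → x′ ≡ y′
  divide-by-b² {x′ = x′} {y′} b²x′≡x b²y′≡y x≡y =
    *-cancelˡ-≡ x′ y′ (b ^ 2) (trans b²x′≡x (trans x≡y (sym b²y′≡y)))
  b²*c²b≡c²b³ : b ^ 2 * (c ^ 2 * b) ≡ c ^ 2 * b ^ 3
  b²*c²b≡c²b³ = solve 2 (λ b c → b :^ 2 :* (c :^ 2 :* b) := c :^ 2 :* b :^ 3) refl b c
  b²*kab²j²≡kab²d² : b ^ 2 * (k * a * b ^ 2 * j ^ 2) ≡ k * a * b ^ 2 * d ^ 2
  b²*kab²j²≡kab²d² = trans
    (solve 4 (λ k a b j → b :^ 2 :* (k :* a :* b :^ 2 :* j :^ 2) := k :* a :* b :^ 2 :* (j :* b) :^ 2)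
             refl k a b j)
    (cong (λ t → k * a * b ^ 2 * t ^ 2) (sym d≡jb))
  b²*a³j²≡a³d² : b ^ 2 * (a ^ 3 * j ^ 2) ≡ a ^ 3 * d ^ 2
  b²*a³j²≡a³d² = trans
    (solve 3 (λ a b j → b :^ 2 :* (a :^ 3 :* j :^ 2) := a :^ 3 :* (j :* b) :^ 2) refl a b j)
    (cong (λ t → a ^ 3 * t ^ 2) (sym d≡jb))
  reduced : c ^ 2 * b + k * a * b ^ 2 * j ^ 2 ≡ a ^ 3 * j ^ 2 ⊎
            c ^ 2 * b + a ^ 3 * j ^ 2 ≡ k * a * b ^ 2 * j ^ 2
  reduced = Sum.map
    (divide-by-b² (trans (*-distribˡ-+ (b ^ 2) _ _) (cong₂ _+_ b²*c²b≡c²b³ b²*kab²j²≡kab²d²)) b²*a³j²≡a³d²)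
    (divide-by-b² (trans (*-distribˡ-+ (b ^ 2) _ _) (cong₂ _+_ b²*c²b≡c²b³ b²*a³j²≡a³d²)) b²*kab²j²≡kab²d²)
    eq
  j²∣kab²j² : j ^ 2 ∣ k * a * b ^ 2 * j ^ 2
  j²∣kab²j² = n∣m*n (k * a * b ^ 2)
  j²∣a³j² : j ^ 2 ∣ a ^ 3 * j ^ 2
  j²∣a³j² = n∣m*n (a ^ 3)
  j²∣c²b : j ^ 2 ∣ c ^ 2 * b
  j²∣c²b = [ (λ pos → ∣m+n∣m⇒∣n (subst (j ^ 2 ∣_) (trans (sym pos) (+-comm (c ^ 2 * b) _)) j²∣a³j²) j²∣kab²j²)
           , (λ neg → ∣m+n∣m⇒∣n (subst (j ^ 2 ∣_) (trans (sym neg) (+-comm (c ^ 2 * b) _)) j²∣kab²j²) j²∣a³j²)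
           ]′ reduced
  b∣c²b : b ∣ c ^ 2 * b
  b∣c²b = n∣m*n (c ^ 2)
  b∣kab²j² : b ∣ k * a * b ^ 2 * j ^ 2
  b∣kab²j² = ∣m⇒∣m*n (j ^ 2) (∣n⇒∣m*n (k * a) (∣⇒∣^ 2 ∣-refl))
  b∣a³j² : b ∣ a ^ 3 * j ^ 2
  b∣a³j² = [ (λ pos → subst (b ∣_) pos (∣m∣n⇒∣m+n b∣c²b b∣kab²j²))
           , (λ neg → ∣m+n∣m⇒∣n (subst (b ∣_) (sym neg) b∣kab²j²) b∣c²b) ]′ reduced
  b≡j² : b ≡ j ^ 2
  b≡j² = ∣-antisym
    (coprime-divisor (coprime-^ʳ 3 (Coprimality.sym a⊥b)) b∣a³j²)
    (coprime-divisor (coprime-^ 2 2 (coprime-∣ˡ (divides b (trans d≡jb (*-comm j b))) (Coprimality.sym c⊥d)))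
                     j²∣c²b)

-- Residues of powers

%-distribˡ-^ : ∀ m k n .{{_ : NonZero n}} → m ^ k % n ≡ (m % n) ^ k % n
%-distribˡ-^ m zero    n = refl
%-distribˡ-^ m (suc k) n = begin
  m * m ^ k % n                       ≡⟨ %-distribˡ-* m (m ^ k) n ⟩
  m % n * (m ^ k % n) % n             ≡⟨ cong (λ r → m % n * r % n) (%-distribˡ-^ m k n) ⟩
  m % n * ((m % n) ^ k % n) % n       ≡⟨ cong (λ r → r * ((m % n) ^ k % n) % n) (m%n%n≡m%n m n) ⟨
  m % n % n * ((m % n) ^ k % n) % n   ≡⟨ %-distribˡ-* (m % n) ((m % n) ^ k) n ⟨
  m % n * (m % n) ^ k % n             ∎
  where open ≡-Reasoning

powerResidues : ℕ → (n : ℕ) .{{_ : NonZero n}} → List ℕ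
powerResidues k n = map (λ r → r ^ k % n) (upTo n)

^%∈powerResidues : ∀ k n .{{_ : NonZero n}} m → m ^ k % n ∈ powerResidues k n
^%∈powerResidues k n m = subst (_∈ powerResidues k n) (sym (%-distribˡ-^ m k n))
  (∈-map⁺ (λ r → r ^ k % n) (∈-upTo⁺ (m%n<n m n)))

odd⇒^2%8≡1 : ¬ 2 ∣ m → m ^ 2 % 8 ≡ 1
odd⇒^2%8≡1 {m} m-odd = trans (%-distribˡ-^ m 2 8)
  (lookup table (∈-upTo⁺ (m%n<n m 8)) (m-odd ∘ ∣n∣m%n⇒∣m (divides 4 refl)))
  where
  table : All (λ r → ¬ 2 ∣ r → r ^ 2 % 8 ≡ 1) (upTo 8)
  table = from-yes (all? (λ r → ¬? (2 ∣? r) →-dec r ^ 2 % 8 ≟ 1) (upTo 8))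

odd⇒^4%8≡1 : ¬ 2 ∣ m → m ^ 4 % 8 ≡ 1
odd⇒^4%8≡1 {m} m-odd =
  trans (cong (_% 8) (sym (^-*-assoc m 2 2))) (odd⇒^2%8≡1 (m-odd ∘ prime∣^⇒∣ 2 prime[2]))

even⇒^4%8≡0 : 2 ∣ m → m ^ 4 % 8 ≡ 0
even⇒^4%8≡0 (divides k refl) = trans
  (cong (_% 8) (solve 1 (λ k → (k :* con 2) :^ 4 := con 2 :* k :^ 4 :* con 8) refl k))
  (m*n%n≡0 (2 * k ^ 4) 8)

+-%-cong : ∀ a b n .{{_ : NonZero n}} → a % n ≡ c → b % n ≡ d → (a + b) % n ≡ (c + d) % n
+-%-cong {c} {d} a b n a≡c b≡d = trans (%-distribˡ-+ a b n) (cong₂ (λ x y → (x + y) % n) a≡c b≡d)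

*-%-cong : ∀ a b n .{{_ : NonZero n}} → a % n ≡ c → b % n ≡ d → (a * b) % n ≡ (c * d) % n
*-%-cong {c} {d} a b n a≡c b≡d = trans (%-distribˡ-* a b n) (cong₂ (λ x y → (x * y) % n) a≡c b≡d)

-- The descent

module _ (p : ℕ) (p-prime : Prime p) (p%8≡7 : p % 8 ≡ 7) (p%5∈[2,3] : p % 5 ∈ 2 ∷ 3 ∷ []) where

  private
    instance
      p≢0 : NonZero p
      p≢0 = prime⇒nonZero p-prime

  5p%8≡3 : 5 * p % 8 ≡ 3
  5p%8≡3 = *-%-cong 5 p 8 refl p%8≡7

  5p*odd⁴%8≡3 : ¬ 2 ∣ m → 5 * p * m ^ 4 % 8 ≡ 3
  5p*odd⁴%8≡3 {m} m-odd = *-%-cong (5 * p) (m ^ 4) 8 5p%8≡3 (odd⇒^4%8≡1 m-odd)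

  -- x² ≡ p y² (mod 5) without subtraction: p is a quadratic non-residue modulo 5.
  nonresidue-mod-5 : x ^ 2 + a * 5 ≡ p * y ^ 2 + b * 5 → 5 ∣ y
  nonresidue-mod-5 {x} {a} {y} {b} eq = prime∣^⇒∣ 2 prime[5] (m%n≡0⇒n∣m (y ^ 2) 5
    (lookup (lookup (lookup table p%5∈[2,3]) (^%∈powerResidues 2 5 x)) (^%∈powerResidues 2 5 y) residue-eq))
    where
    residue-eq : x ^ 2 % 5 ≡ p % 5 * (y ^ 2 % 5) % 5
    residue-eq = begin
      x ^ 2 % 5               ≡⟨ [m+kn]%n≡m%n (x ^ 2) a 5 ⟨
      (x ^ 2 + a * 5) % 5     ≡⟨ cong (_% 5) eq ⟩
      (p * y ^ 2 + b * 5) % 5 ≡⟨ [m+kn]%n≡m%n (p * y ^ 2) b 5 ⟩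
      p * y ^ 2 % 5           ≡⟨ %-distribˡ-* p (y ^ 2) 5 ⟩
      p % 5 * (y ^ 2 % 5) % 5 ∎
      where open ≡-Reasoning
    table : All (λ c → All (λ s → All (λ t → s ≡ c * t % 5 → t ≡ 0)
              (powerResidues 2 5)) (powerResidues 2 5)) (2 ∷ 3 ∷ [])
    table = from-yes (all? (λ c → all? (λ s → all? (λ t → s ≟ c * t % 5 →-dec t ≟ 0)
              (powerResidues 2 5)) (powerResidues 2 5)) (2 ∷ 3 ∷ []))

  data Splitting : ℕ → ℕ → Set where
    1·5p : Splitting 1 (5 * p)
    5·p  : Splitting 5 p
    p·5  : Splitting p 5
    5p·1 : Splitting (5 * p) 1

  splitting-swap : Splitting d₁ d₂ → Splitting d₂ d₁
  splitting-swap 1·5p = 5p·1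
  splitting-swap 5·p  = p·5
  splitting-swap p·5  = 5·p
  splitting-swap 5p·1 = 1·5p

  splitting-product : Splitting d₁ d₂ → d₁ * d₂ ≡ 5 * p
  splitting-product 1·5p = *-identityˡ (5 * p)
  splitting-product 5·p  = refl
  splitting-product p·5  = *-comm p 5
  splitting-product 5p·1 = *-identityʳ (5 * p)

  ∣5p⇒splitting : d₁ ∣ 5 * p → ∃ λ d₂ → Splitting d₁ d₂
  ∣5p⇒splitting {d₁} d₁∣5p with p ∣? d₁
  ... | yes (divides j refl) with prime⇒irreducible prime[5] (*-cancelʳ-∣ {j} {5} p d₁∣5p)
  ...   | inj₁ refl = 5 , subst (λ d → Splitting d 5) (sym (*-identityˡ p)) p·5
  ...   | inj₂ refl = 1 , 5p·1
  ∣5p⇒splitting {d₁} d₁∣5p | no p∤d₁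
    with prime⇒irreducible prime[5] (coprime-divisor (Coprimality.sym (¬∣⇒coprime p-prime p∤d₁))
                                        (subst (d₁ ∣_) (*-comm 5 p) d₁∣5p))
  ...   | inj₁ refl = 5 * p , 1·5p
  ...   | inj₂ refl = p , 5·p

  p≢5 : p ≢ 5
  p≢5 refl = contradiction p%8≡7 λ ()

  p≢1 : p ≢ 1
  p≢1 refl = contradiction p%8≡7 λ ()

  5p≢1 : 5 * p ≢ 1
  5p≢1 5p≡1 = contradiction (m*n≡1⇒m≡1 5 p 5p≡1) λ ()

  squarefree-5p : d₁ ^ 2 ∣ 5 * p → d₁ ≡ 1
  squarefree-5p {d₁} d₁²∣5p with ∣5p⇒splitting {d₁} (∣-trans (∣⇒∣^ 2 ∣-refl) d₁²∣5p)
  ... | _ , 1·5p = refl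
  ... | _ , 5·p  = contradiction (prime⇒irreducible p-prime (*-cancelˡ-∣ {5} {p} 5 d₁²∣5p))
                                 [ (λ ()) , p≢5 ∘ sym ]′
  ... | _ , p·5  = contradiction (prime⇒irreducible prime[5]
                                   (*-cancelʳ-∣ {p} {5} p (subst (_∣ 5 * p) (m^2≡m*m p) d₁²∣5p)))
                                 [ p≢1 , p≢5 ]′
  ... | _ , 5p·1 = contradiction (∣1⇒≡1 (*-cancelˡ-∣ {5 * p} {1} (5 * p)
                                   (subst₂ _∣_ (m^2≡m*m (5 * p)) (sym (*-identityʳ (5 * p))) d₁²∣5p)))
                                 5p≢1
    where
    instance
      5p≢0 : NonZero (5 * p)
      5p≢0 = m*n≢0 5 p

  split-by-5p : m * n ≡ 5 * p * k →
             ∃₂ λ d₁ d₂ → Splitting d₁ d₂ × ∃₂ λ m′ n′ → m ≡ d₁ * m′ × n ≡ d₂ * n′ × m′ * n′ ≡ k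
  split-by-5p {m} {n} {k} mn≡5pk
    with prime∣*⇒split {m = m} {n = n} {k = p * k} prime[5] (trans mn≡5pk (*-assoc 5 p k))
  ... | inj₁ (m₁ , refl , m₁n≡pk) with prime∣*⇒split {m = m₁} {n = n} {k = k} p-prime m₁n≡pk
  ...   | inj₁ (m₂ , refl , m₂n≡k)  = _ , _ , 5p·1 , m₂ , n , sym (*-assoc 5 p m₂) , sym (*-identityˡ n) , m₂n≡k
  ...   | inj₂ (n₂ , refl , m₁n₂≡k) = _ , _ , 5·p , m₁ , n₂ , refl , refl , m₁n₂≡k
  split-by-5p {m} {n} {k} mn≡5pk | inj₂ (n₁ , refl , mn₁≡pk)
    with prime∣*⇒split {m = m} {n = n₁} {k = k} p-prime mn₁≡pk
  ...   | inj₁ (m₂ , refl , m₂n₁≡k) = _ , _ , p·5 , m₂ , n₁ , refl , refl , m₂n₁≡k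
  ...   | inj₂ (n₂ , refl , mn₂≡k)  = _ , _ , 1·5p , m , n₂ , sym (*-identityˡ m) , sym (*-assoc 5 p n₂) , mn₂≡k

  split-fourth-powers : Coprime m n → m * n ≡ 5 * p * f ^ 4 →
    ∃₂ λ d₁ d₂ → Splitting d₁ d₂ × ∃₂ λ u v → m ≡ d₁ * u ^ 4 × n ≡ d₂ * v ^ 4 × u * v ≡ f × Coprime u v
  split-fourth-powers {m} {n} {f} m⊥n mn≡5pf⁴
    with d₁ , d₂ , s , m′ , n′ , refl , refl , m′n′≡f⁴ ← split-by-5p {m} {n} mn≡5pf⁴
    with u , v , refl , refl , uv≡f
           ← coprime∧*≡^4⇒^4×^4 {c = f} (coprime-∣ˡ (n∣m*n d₁) (coprime-∣ʳ (n∣m*n d₂) m⊥n)) m′n′≡f⁴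
    = d₁ , d₂ , s , u , v , refl , refl , uv≡f ,
      coprime-^⁻ 4 4 (coprime-∣ˡ (n∣m*n d₁) (coprime-∣ʳ (n∣m*n d₂) m⊥n))

  -- For d₁ d₂ = 5p these are the 2-coverings of E : y² = x³ - 5p x and of the 2-isogenous
  -- curve E′ : y² = x³ + 20p x. Only Covering 1 (5 * p) and Covering′ (5 * p) 1, which contain
  -- the images of the points at infinity, survive the congruence conditions.
  Covering : ℕ → ℕ → ℕ → ℕ → ℕ → Set
  Covering d₁ d₂ m n w = w ^ 2 + d₂ * n ^ 4 ≡ d₁ * m ^ 4

  Covering′ : ℕ → ℕ → ℕ → ℕ → ℕ → Set
  Covering′ d₁ d₂ m u v = m ^ 2 ≡ 4 * d₁ * u ^ 4 + d₂ * v ^ 4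

  no-covering-5p·1 : Coprime m n → ¬ Covering (5 * p) 1 m n w
  no-covering-5p·1 {m} {n} {w} m⊥n eq with 2 ∣? m
  ... | no m-odd = lookup (lookup table (^%∈powerResidues 2 8 w)) (^%∈powerResidues 4 8 n) (begin
    (w ^ 2 % 8 + n ^ 4 % 8) % 8 ≡⟨ %-distribˡ-+ (w ^ 2) (n ^ 4) 8 ⟨
    (w ^ 2 + n ^ 4) % 8         ≡⟨ cong (λ t → (w ^ 2 + t) % 8) (*-identityˡ (n ^ 4)) ⟨
    (w ^ 2 + 1 * n ^ 4) % 8     ≡⟨ cong (_% 8) eq ⟩
    5 * p * m ^ 4 % 8           ≡⟨ 5p*odd⁴%8≡3 m-odd ⟩
    3                           ∎)
    where
    open ≡-Reasoning
    table : All (λ a → All (λ b → (a + b) % 8 ≢ 3) (powerResidues 4 8)) (powerResidues 2 8)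
    table = from-yes (all? (λ a → all? (λ b → ¬? ((a + b) % 8 ≟ 3)) (powerResidues 4 8))
                           (powerResidues 2 8))
  ... | yes 2∣m = lookup table (^%∈powerResidues 2 8 w) (begin
    (w ^ 2 % 8 + 1) % 8     ≡⟨ +-%-cong (w ^ 2) (1 * n ^ 4) 8 refl n⁴%8≡1 ⟨
    (w ^ 2 + 1 * n ^ 4) % 8 ≡⟨ cong (_% 8) eq ⟩
    5 * p * m ^ 4 % 8       ≡⟨ *-%-cong (5 * p) (m ^ 4) 8 5p%8≡3 (even⇒^4%8≡0 2∣m) ⟩
    0                       ∎)
    where
    open ≡-Reasoning
    n⁴%8≡1 : 1 * n ^ 4 % 8 ≡ 1
    n⁴%8≡1 = trans (cong (_% 8) (*-identityˡ (n ^ 4)))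
                   (odd⇒^4%8≡1 λ 2∣n → contradiction (m⊥n (2∣m , 2∣n)) λ ())
    table : All (λ a → (a + 1) % 8 ≢ 0) (powerResidues 2 8)
    table = from-yes (all? (λ a → ¬? ((a + 1) % 8 ≟ 0)) (powerResidues 2 8))

  no-covering-5·p : Coprime m n → ¬ Covering 5 p m n w
  no-covering-5·p {m} {n} {w} m⊥n eq = contradiction (m⊥n (5∣m , 5∣n)) λ ()
    where
    open ≡-Reasoning
    5∣n : 5 ∣ n
    5∣n = prime∣^⇒∣ 2 prime[5] (nonresidue-mod-5 {2 * w} {p * n ^ 4} {n ^ 2} {4 * m ^ 4} (begin
      (2 * w) ^ 2 + p * n ^ 4 * 5   ≡⟨ solve 3 (λ w p n → (con 2 :* w) :^ 2 :+ p :* n :^ 4 :* con 5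
                                         := con 4 :* (w :^ 2 :+ p :* n :^ 4) :+ p :* n :^ 4) refl w p n ⟩
      4 * (w ^ 2 + p * n ^ 4) + p * n ^ 4 ≡⟨ cong (λ t → 4 * t + p * n ^ 4) eq ⟩
      4 * (5 * m ^ 4) + p * n ^ 4   ≡⟨ solve 3 (λ m p n → con 4 :* (con 5 :* m :^ 4) :+ p :* n :^ 4
                                         := p :* (n :^ 2) :^ 2 :+ con 4 :* m :^ 4 :* con 5) refl m p n ⟩
      p * (n ^ 2) ^ 2 + 4 * m ^ 4 * 5 ∎))
    5∣w : 5 ∣ w
    5∣w = prime∣^⇒∣ 2 prime[5] (∣m+n∣m⇒∣n
      (subst (5 ∣_) (trans (sym eq) (+-comm (w ^ 2) (p * n ^ 4))) (m∣m*n (m ^ 4)))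
      (∣n⇒∣m*n p (∣⇒∣^ 4 5∣n)))
    5∣m : 5 ∣ m
    5∣m = prime∣^⇒∣ 4 prime[5] (*-cancelˡ-∣ {5} {m ^ 4} 5 (subst (25 ∣_) eq
      (∣m∣n⇒∣m+n (^-monoˡ-∣ 2 5∣w) (∣n⇒∣m*n p (∣-trans (divides 25 refl) (^-monoˡ-∣ 4 5∣n))))))

  no-covering-p·5 : Coprime m n → ¬ Covering p 5 m n w
  no-covering-p·5 {m} {n} {w} m⊥n eq = contradiction (m⊥n (5∣m , 5∣n)) λ ()
    where
    open ≡-Reasoning
    5∣m : 5 ∣ m
    5∣m = prime∣^⇒∣ 2 prime[5] (nonresidue-mod-5 {w} {n ^ 4} {m ^ 2} {0} (begin
      w ^ 2 + n ^ 4 * 5     ≡⟨ cong (λ z → w ^ 2 + z) (*-comm (n ^ 4) 5) ⟩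
      w ^ 2 + 5 * n ^ 4     ≡⟨ eq ⟩
      p * m ^ 4             ≡⟨ solve 2 (λ p m → p :* m :^ 4 := p :* (m :^ 2) :^ 2 :+ con 0 :* con 5) refl p m ⟩
      p * (m ^ 2) ^ 2 + 0 * 5 ∎))
    5∣w : 5 ∣ w
    5∣w = prime∣^⇒∣ 2 prime[5] (∣m+n∣m⇒∣n
      (subst (5 ∣_) (trans (sym eq) (+-comm (w ^ 2) (5 * n ^ 4))) (∣n⇒∣m*n p (∣⇒∣^ 4 5∣m)))
      (m∣m*n (n ^ 4)))
    5∣n : 5 ∣ n
    5∣n = prime∣^⇒∣ 4 prime[5] (*-cancelˡ-∣ {5} {n ^ 4} 5 (∣m+n∣m⇒∣n
      (subst (25 ∣_) (sym eq) (∣n⇒∣m*n p (∣-trans (divides 25 refl) (^-monoˡ-∣ 4 5∣m))))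
      (^-monoˡ-∣ 2 5∣w)))

  no-covering′-1·5p : ¬ 2 ∣ m → ¬ Covering′ 1 (5 * p) m u v
  no-covering′-1·5p {m} {u} {v} m-odd eq =
    lookup (lookup table (^%∈powerResidues 4 8 u)) (^%∈powerResidues 4 8 v) (begin
      (4 * (u ^ 4 % 8) % 8 + 3 * (v ^ 4 % 8) % 8) % 8
        ≡⟨ +-%-cong (4 * u ^ 4) (5 * p * v ^ 4) 8 (*-%-cong 4 (u ^ 4) 8 refl refl)
                                                   (*-%-cong (5 * p) (v ^ 4) 8 5p%8≡3 refl) ⟨
      (4 * u ^ 4 + 5 * p * v ^ 4) % 8 ≡⟨ cong (_% 8) eq ⟨
      m ^ 2 % 8                       ≡⟨ odd⇒^2%8≡1 m-odd ⟩
      1                               ∎)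
    where
    open ≡-Reasoning
    table : All (λ a → All (λ b → (4 * a % 8 + 3 * b % 8) % 8 ≢ 1) (powerResidues 4 8)) (powerResidues 4 8)
    table = from-yes (all? (λ a → all? (λ b → ¬? ((4 * a % 8 + 3 * b % 8) % 8 ≟ 1))
              (powerResidues 4 8)) (powerResidues 4 8))

  no-covering′-5·p : Coprime m v → ¬ Covering′ 5 p m u v
  no-covering′-5·p {m} {v} {u} m⊥v eq = contradiction (m⊥v (5∣m , 5∣v)) λ ()
    where
    open ≡-Reasoning
    5∣v : 5 ∣ v
    5∣v = prime∣^⇒∣ 2 prime[5] (nonresidue-mod-5 {m} {0} {v ^ 2} {4 * u ^ 4} (begin
      m ^ 2 + 0 * 5                 ≡⟨ +-identityʳ (m ^ 2) ⟩
      m ^ 2                         ≡⟨ eq ⟩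
      20 * u ^ 4 + p * v ^ 4        ≡⟨ solve 3 (λ u p v → con 20 :* u :^ 4 :+ p :* v :^ 4
                                         := p :* (v :^ 2) :^ 2 :+ con 4 :* u :^ 4 :* con 5) refl u p v ⟩
      p * (v ^ 2) ^ 2 + 4 * u ^ 4 * 5 ∎))
    5∣m : 5 ∣ m
    5∣m = prime∣^⇒∣ 2 prime[5] (subst (5 ∣_) (sym eq)
      (∣m∣n⇒∣m+n (∣m⇒∣m*n (u ^ 4) (divides 4 refl)) (∣n⇒∣m*n p (∣⇒∣^ 4 5∣v))))

  no-covering′-p·5 : Coprime m u → ¬ Covering′ p 5 m u v
  no-covering′-p·5 {m} {u} {v} m⊥u eq = contradiction (m⊥u (5∣m , 5∣u)) λ ()
    where
    open ≡-Reasoning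
    5∣u : 5 ∣ u
    5∣u = prime∣^⇒∣ 2 prime[5] (nonresidue-mod-5 {2 * m} {0} {u ^ 2} {3 * p * u ^ 4 + 4 * v ^ 4} (begin
      (2 * m) ^ 2 + 0 * 5             ≡⟨ solve 1 (λ m → (con 2 :* m) :^ 2 :+ con 0 :* con 5 := con 4 :* m :^ 2)
                                               refl m ⟩
      4 * m ^ 2                       ≡⟨ cong (4 *_) eq ⟩
      4 * (4 * p * u ^ 4 + 5 * v ^ 4) ≡⟨ solve 3 (λ p u v → con 4 :* (con 4 :* p :* u :^ 4 :+ con 5 :* v :^ 4)
                                           := p :* (u :^ 2) :^ 2 :+ (con 3 :* p :* u :^ 4 :+ con 4 :* v :^ 4) :* con 5)
                                           refl p u v ⟩
      p * (u ^ 2) ^ 2 + (3 * p * u ^ 4 + 4 * v ^ 4) * 5 ∎))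
    5∣m : 5 ∣ m
    5∣m = prime∣^⇒∣ 2 prime[5] (subst (5 ∣_) (sym eq)
      (∣m∣n⇒∣m+n (∣n⇒∣m*n (4 * p) (∣⇒∣^ 4 5∣u)) (m∣m*n (v ^ 4))))

  no-covering-1·5p-odd : ¬ 2 ∣ n → ¬ Covering 1 (5 * p) m n w
  no-covering-1·5p-odd {n} {m} {w} n-odd eq =
    lookup (lookup table (^%∈powerResidues 2 8 w)) (^%∈powerResidues 4 8 m) (begin
      (w ^ 2 % 8 + 3) % 8         ≡⟨ +-%-cong (w ^ 2) (5 * p * n ^ 4) 8 refl (5p*odd⁴%8≡3 n-odd) ⟨
      (w ^ 2 + 5 * p * n ^ 4) % 8 ≡⟨ cong (_% 8) (trans eq (*-identityˡ (m ^ 4))) ⟩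
      m ^ 4 % 8                   ∎)
    where
    open ≡-Reasoning
    table : All (λ a → All (λ b → (a + 3) % 8 ≢ b) (powerResidues 4 8)) (powerResidues 2 8)
    table = from-yes (all? (λ a → all? (λ b → ¬? ((a + 3) % 8 ≟ b)) (powerResidues 4 8))
                           (powerResidues 2 8))

  -- A common divisor i of a and b has i ^ 2 ∣ 5 p k, hence i ^ 2 ∣ 5 p when i is coprime to k.
  *≡5p*⇒coprime : (∀ {i} → i ∣ a → i ∣ b → Coprime i k) → a * b ≡ 5 * p * k → Coprime a b
  *≡5p*⇒coprime {a} {b} {k} common⊥k ab≡5pk {i} (i∣a , i∣b) = squarefree-5p
    (coprime-divisor (coprime-^ˡ 2 (common⊥k i∣a i∣b))
      (subst₂ _∣_ (sym (m^2≡m*m i)) (trans ab≡5pk (*-comm (5 * p) k)) (*-pres-∣ i∣a i∣b)))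

  coprime-halves′ : Coprime s r → a * (r ^ 2 + a) ≡ 5 * p * s ^ 4 → Coprime a (r ^ 2 + a)
  coprime-halves′ {s} {r} {a} s⊥r = *≡5p*⇒coprime {k = s ^ 4} λ {i} i∣a i∣r²+a →
    coprime-∣ˡ (∣m+n∣m⇒∣n (subst (i ∣_) (+-comm (r ^ 2) a) i∣r²+a) i∣a) (coprime-^ 2 4 (Coprimality.sym s⊥r))

  trivial-covering : Splitting d₁ d₂ → Coprime m n → Covering d₁ d₂ m n w → Covering 1 (5 * p) m n w
  trivial-covering                  1·5p _   eq = eq
  trivial-covering {m = m} {n} {w} 5·p  m⊥n eq = contradiction eq (no-covering-5·p {m} {n} {w} m⊥n)
  trivial-covering {m = m} {n} {w} p·5  m⊥n eq = contradiction eq (no-covering-p·5 {m} {n} {w} m⊥n)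
  trivial-covering {m = m} {n} {w} 5p·1 m⊥n eq = contradiction eq (no-covering-5p·1 {m} {n} {w} m⊥n)

  trivial-covering′ : Splitting d₁ d₂ → ¬ 2 ∣ m → Coprime m u → Coprime m v →
                      Covering′ d₁ d₂ m u v → Covering′ (5 * p) 1 m u v
  trivial-covering′ {m = m} {u} {v} 1·5p m-odd _ _ eq = contradiction eq (no-covering′-1·5p {m} {u} {v} m-odd)
  trivial-covering′ {m = m} {u} {v} 5·p _ _ m⊥v eq   = contradiction eq (no-covering′-5·p {m} {v} {u} m⊥v)
  trivial-covering′ {m = m} {u} {v} p·5 _ m⊥u _ eq   = contradiction eq (no-covering′-p·5 {m} {u} {v} m⊥u)
  trivial-covering′ 5p·1 _ _ _ eq = eq

  descend′ : s ≢ 0 → Coprime s r → Covering′ (5 * p) 1 M s r →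
             ∃ λ n → n ≢ 0 × n ≤ s × ∃₂ λ m w → Coprime m n × Covering 1 (5 * p) m n w
  descend′ {s} {r} {M} s≢0 s⊥r eq =
    let R , _ , RS≡5ps⁴ = halving {M} {r ^ 2} {5 * p * s ^ 4} eq′
        d₁ , d₂ , splitting , u , v , R≡d₁u⁴ , S≡d₂v⁴ , uv≡s , u⊥v =
          split-fourth-powers {R} {r ^ 2 + R} {s} (coprime-halves′ {s} {r} {R} s⊥r RS≡5ps⁴) RS≡5ps⁴
        u≢0 , u≤s = m*n≡o≢0⇒m≢0×m≤o {u} {v} {s} uv≡s s≢0
    in  u , u≢0 , u≤s , v , r , Coprimality.sym u⊥v ,
        trivial-covering {d₂} {d₁} {v} {u} {r} (splitting-swap splitting) (Coprimality.sym u⊥v)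
          (trans (cong (λ z → r ^ 2 + z) (sym R≡d₁u⁴)) S≡d₂v⁴)
    where
    eq′ : M ^ 2 ≡ (r ^ 2) ^ 2 + 4 * (5 * p * s ^ 4)
    eq′ = trans eq (solve 3 (λ p s r → con 4 :* (con 5 :* p) :* s :^ 4 :+ con 1 :* r :^ 4
                             := (r :^ 2) :^ 2 :+ con 4 :* (con 5 :* p :* s :^ 4)) refl p s r)

  coprime-halves : ¬ 2 ∣ m → Coprime m f → a + b ≡ m ^ 2 → a * b ≡ 4 * (5 * p * f ^ 4) → Coprime a b
  coprime-halves {m} {f} {a} {b} m-odd m⊥f a+b≡m² ab≡4·5pf⁴ = *≡5p*⇒coprime {k = 4 * f ^ 4}
    (λ {i} i∣a i∣b → coprime-∣ˡ (subst (i ∣_) a+b≡m² (∣m∣n⇒∣m+n i∣a i∣b))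
      (coprime-*ʳ (coprime-^ 2 2 (Coprimality.sym (¬∣⇒coprime prime[2] m-odd))) (coprime-^ 2 4 m⊥f)))
    (trans ab≡4·5pf⁴ (solve 2 (λ p f → con 4 :* (con 5 :* p :* f :^ 4) := con 5 :* p :* (con 4 :* f :^ 4))
                              refl p f))

  -- The even half is coprime to the other one, so it carries the whole factor 4.
  descend-from-halves : ¬ 2 ∣ m → Coprime m f → f ≢ 0 → a + b ≡ m ^ 2 → Coprime a b →
                        a * b ≡ 4 * (5 * p * f ^ 4) → 2 ∣ a →
                        ∃ λ s → s ≢ 0 × s ≤ f × ∃₂ λ M r → Coprime s r × Covering′ (5 * p) 1 M s r
  descend-from-halves {m} {f} {a} {b} m-odd m⊥f f≢0 a+b≡m² a⊥b ab≡4·5pf⁴ 2∣a =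
    let d₁ , d₂ , splitting , u , v , a₀≡d₁u⁴ , b≡d₂v⁴ , uv≡f , u⊥v =
          split-fourth-powers {a₀} {b} {f} (coprime-∣ˡ (divides 4 a≡4a₀) a⊥b) a₀b≡5pf⁴
        u≢0 , u≤f = m*n≡o≢0⇒m≢0×m≤o {u} {v} {f} uv≡f f≢0
    in  u , u≢0 , u≤f , m , v , u⊥v ,
        trivial-covering′ {d₁} {d₂} {m} {u} {v} splitting m-odd
          (coprime-∣ʳ (divides v (trans (sym uv≡f) (*-comm u v))) m⊥f)
          (coprime-∣ʳ (divides u (sym uv≡f)) m⊥f)
          (begin
            m ^ 2                         ≡⟨ a+b≡m² ⟨
            a + b                         ≡⟨ cong₂ _+_ a≡4a₀ b≡d₂v⁴ ⟩
            4 * a₀ + d₂ * v ^ 4           ≡⟨ cong (λ z → 4 * z + d₂ * v ^ 4) a₀≡d₁u⁴ ⟩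
            4 * (d₁ * u ^ 4) + d₂ * v ^ 4 ≡⟨ cong (_+ d₂ * v ^ 4) (*-assoc 4 d₁ (u ^ 4)) ⟨
            4 * d₁ * u ^ 4 + d₂ * v ^ 4   ∎)
    where
    open ≡-Reasoning
    4∣a : 4 ∣ a
    4∣a = coprime-divisor
            (coprime-^ˡ 2 (¬∣⇒coprime prime[2] λ 2∣b → contradiction (a⊥b (2∣a , 2∣b)) λ ()))
            (subst (4 ∣_) (trans (sym ab≡4·5pf⁴) (*-comm a b)) (m∣m*n (5 * p * f ^ 4)))
    a₀ : ℕ
    a₀ = quotient 4∣a
    a≡4a₀ : a ≡ 4 * a₀
    a≡4a₀ = m∣n⇒n≡m*quotient 4∣a
    a₀b≡5pf⁴ : a₀ * b ≡ 5 * p * f ^ 4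
    a₀b≡5pf⁴ = *-cancelˡ-≡ _ _ 4
      (trans (sym (*-assoc 4 a₀ b)) (trans (cong (_* b) (sym a≡4a₀)) ab≡4·5pf⁴))

  descend-even : f ≢ 0 → Coprime m (f * 2) → Covering 1 (5 * p) m (f * 2) w →
                 ∃ λ s → s ≢ 0 × s ≤ f × ∃₂ λ M r → Coprime s r × Covering′ (5 * p) 1 M s r
  descend-even {f} {m} {w} f≢0 m⊥2f eq =
    [ descend-from-halves m-odd m⊥f f≢0 R+S≡m² R⊥S RS≡4·5pf⁴
    , descend-from-halves m-odd m⊥f f≢0 (trans (+-comm S R) R+S≡m²) (Coprimality.sym R⊥S)
                                        (trans (*-comm S R) RS≡4·5pf⁴)
    ]′ (euclidsLemma R S prime[2]
         (subst (2 ∣_) (sym RS≡4·5pf⁴) (∣m⇒∣m*n (5 * p * f ^ 4) (divides 2 refl))))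
    where
    open ≡-Reasoning
    m-odd : ¬ 2 ∣ m
    m-odd 2∣m = contradiction (m⊥2f (2∣m , n∣m*n f)) λ ()
    m⊥f : Coprime m f
    m⊥f = coprime-∣ʳ (m∣m*n 2) m⊥2f
    halves : ∃ λ R → m ^ 2 ≡ w + 2 * R × R * (w + R) ≡ 4 * (5 * p * f ^ 4)
    halves = halving (begin
      (m ^ 2) ^ 2                 ≡⟨ solve 1 (λ m → (m :^ 2) :^ 2 := con 1 :* m :^ 4) refl m ⟩
      1 * m ^ 4                   ≡⟨ eq ⟨
      w ^ 2 + 5 * p * (f * 2) ^ 4 ≡⟨ solve 3 (λ w p f → w :^ 2 :+ con 5 :* p :* (f :* con 2) :^ 4
                                          := w :^ 2 :+ con 4 :* (con 4 :* (con 5 :* p :* f :^ 4))) refl w p f ⟩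
      w ^ 2 + 4 * (4 * (5 * p * f ^ 4)) ∎)
    R S : ℕ
    R = proj₁ halves
    S = w + R
    R+S≡m² : R + S ≡ m ^ 2
    R+S≡m² = trans (solve 2 (λ R w → R :+ (w :+ R) := w :+ con 2 :* R) refl R w)
                   (sym (proj₁ (proj₂ halves)))
    RS≡4·5pf⁴ : R * S ≡ 4 * (5 * p * f ^ 4)
    RS≡4·5pf⁴ = proj₂ (proj₂ halves)
    R⊥S : Coprime R S
    R⊥S = coprime-halves m-odd m⊥f R+S≡m² RS≡4·5pf⁴

  descend : n ≢ 0 → Coprime m n → Covering 1 (5 * p) m n w →
            ∃ λ s → s ≢ 0 × s < n × ∃₂ λ M r → Coprime s r × Covering′ (5 * p) 1 M s r
  descend {n} {m} {w} n≢0 m⊥n eq with 2 ∣? n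
  ... | no n-odd = contradiction eq (no-covering-1·5p-odd {n} {m} {w} n-odd)
  ... | yes (divides f refl) =
    let f≢0 = λ f≡0 → n≢0 (cong (_* 2) f≡0)
        s , s≢0 , s≤f , solution = descend-even {f} {m} {w} f≢0 m⊥n eq
    in  s , s≢0 , ≤-<-trans s≤f (m<m*n f 2 {{≢-nonZero f≢0}} (s≤s (s≤s z≤n))) , solution

  no-covering-1·5p : n ≢ 0 → Coprime m n → ¬ Covering 1 (5 * p) m n w
  no-covering-1·5p {n} {m} {w} = <-rec Insoluble step n {m} {w}
    where
    Insoluble : ℕ → Set
    Insoluble n = ∀ {m w} → n ≢ 0 → Coprime m n → ¬ Covering 1 (5 * p) m n w
    step : ∀ n → (∀ {n′} → n′ < n → Insoluble n′) → Insoluble n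
    step n rec {m} {w} n≢0 m⊥n eq = case descend {n} {m} {w} n≢0 m⊥n eq of λ where
      (s , s≢0 , s<n , M , r , s⊥r , eq′) → case descend′ {s} {r} {M} s≢0 s⊥r eq′ of λ where
        (n′ , n′≢0 , n′≤s , m′ , w′ , m′⊥n′ , eq″) → rec (≤-<-trans n′≤s s<n) {m′} {w′} n′≢0 m′⊥n′ eq″

  no-covering : Splitting d₁ d₂ → n ≢ 0 → Coprime m n → ¬ Covering d₁ d₂ m n w
  no-covering {d₁} {d₂} {n} {m} {w} splitting n≢0 m⊥n eq =
    no-covering-1·5p {n} {m} {w} n≢0 m⊥n (trivial-covering {d₁} {d₂} {m} {n} {w} splitting m⊥n eq)

  -- The abscissa A / e² is, up to squares, a divisor g of 5p.
  square-class : ∀ {A e K C} → A ≢ 0 → Coprime A e → A * K ≡ C ^ 2 →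
                 (∀ {g} → g ∣ A → g ∣ K → g ∣ 5 * p * e ^ 4) →
                 ∃₂ λ g d → Splitting g d × ∃₂ λ M V → A ≡ g * M ^ 2 × K ≡ g * V ^ 2 × Coprime M e
  square-class {A} {e} {K} {C} A≢0 A⊥e AK≡C² common∣5pe⁴ =
    case *≡^2⇒gcd-split {A} {K} {C} A≢0 AK≡C² of λ where
      (g , M , V , A≡gM² , K≡gV² , _) →
        let g∣A = divides (M ^ 2) (trans A≡gM² (*-comm g (M ^ 2)))
            g∣K = divides (V ^ 2) (trans K≡gV² (*-comm g (V ^ 2)))
            d , splitting = ∣5p⇒splitting {g} (coprime-divisor (coprime-^ʳ 4 (coprime-∣ˡ g∣A A⊥e))
                              (subst (g ∣_) (*-comm (5 * p) (e ^ 4)) (common∣5pe⁴ g∣A g∣K)))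
            M∣A = subst (M ∣_) (sym A≡gM²) (∣n⇒∣m*n g (∣⇒∣^ 2 ∣-refl))
        -- η-expanded: the expected type, an implicit function type, is not known yet here
        in  g , d , splitting , M , V , A≡gM² , K≡gV² , λ {i} → coprime-∣ˡ M∣A A⊥e {i}

  cofactor⁺ : A ≢ 0 → C ^ 2 + 5 * p * A * e ^ 4 ≡ A ^ 3 →
              ∃ λ K → 5 * p * e ^ 4 + K ≡ A ^ 2 × A * K ≡ C ^ 2
  cofactor⁺ {A} {C} {e} A≢0 eq = K , 5pe⁴+K≡A² , AK≡C²
    where
    open ≡-Reasoning
    instance
      A≢0′ : NonZero A
      A≢0′ = ≢-nonZero A≢0
    A*5pe⁴≡5pAe⁴ : A * (5 * p * e ^ 4) ≡ 5 * p * A * e ^ 4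
    A*5pe⁴≡5pAe⁴ = solve 3 (λ A p e → A :* (con 5 :* p :* e :^ 4) := con 5 :* p :* A :* e :^ 4) refl A p e
    5pe⁴≤A² : 5 * p * e ^ 4 ≤ A ^ 2
    5pe⁴≤A² = *-cancelˡ-≤ A (subst₂ _≤_ (sym A*5pe⁴≡5pAe⁴) eq (m≤n+m (5 * p * A * e ^ 4) (C ^ 2)))
    K : ℕ
    K = proj₁ (m≤n⇒∃[o]m+o≡n 5pe⁴≤A²)
    5pe⁴+K≡A² : 5 * p * e ^ 4 + K ≡ A ^ 2
    5pe⁴+K≡A² = proj₂ (m≤n⇒∃[o]m+o≡n 5pe⁴≤A²)
    AK≡C² : A * K ≡ C ^ 2
    AK≡C² = +-cancelʳ-≡ (5 * p * A * e ^ 4) (A * K) (C ^ 2) (begin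
      A * K + 5 * p * A * e ^ 4        ≡⟨ cong (λ z → A * K + z) A*5pe⁴≡5pAe⁴ ⟨
      A * K + A * (5 * p * e ^ 4)      ≡⟨ trans (cong (A *_) (+-comm (5 * p * e ^ 4) K))
                                                (*-distribˡ-+ A K (5 * p * e ^ 4)) ⟨
      A * (5 * p * e ^ 4 + K)          ≡⟨ cong (A *_) 5pe⁴+K≡A² ⟩
      A ^ 3                            ≡⟨ eq ⟨
      C ^ 2 + 5 * p * A * e ^ 4        ∎)

  cofactor⁻ : A ≢ 0 → C ^ 2 + A ^ 3 ≡ 5 * p * A * e ^ 4 →
              ∃ λ K → A ^ 2 + K ≡ 5 * p * e ^ 4 × A * K ≡ C ^ 2
  cofactor⁻ {A} {C} {e} A≢0 eq = K , A²+K≡5pe⁴ , AK≡C²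
    where
    open ≡-Reasoning
    instance
      A≢0′ : NonZero A
      A≢0′ = ≢-nonZero A≢0
    A*5pe⁴≡5pAe⁴ : A * (5 * p * e ^ 4) ≡ 5 * p * A * e ^ 4
    A*5pe⁴≡5pAe⁴ = solve 3 (λ A p e → A :* (con 5 :* p :* e :^ 4) := con 5 :* p :* A :* e :^ 4) refl A p e
    A²≤5pe⁴ : A ^ 2 ≤ 5 * p * e ^ 4
    A²≤5pe⁴ = *-cancelˡ-≤ A (subst₂ _≤_ refl (trans eq (sym A*5pe⁴≡5pAe⁴)) (m≤n+m (A ^ 3) (C ^ 2)))
    K : ℕ
    K = proj₁ (m≤n⇒∃[o]m+o≡n A²≤5pe⁴)
    A²+K≡5pe⁴ : A ^ 2 + K ≡ 5 * p * e ^ 4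
    A²+K≡5pe⁴ = proj₂ (m≤n⇒∃[o]m+o≡n A²≤5pe⁴)
    AK≡C² : A * K ≡ C ^ 2
    AK≡C² = +-cancelʳ-≡ (A ^ 3) (A * K) (C ^ 2) (begin
      A * K + A ^ 3             ≡⟨ trans (cong (A *_) (+-comm (A ^ 2) K)) (*-distribˡ-+ A K (A ^ 2)) ⟨
      A * (A ^ 2 + K)           ≡⟨ cong (A *_) A²+K≡5pe⁴ ⟩
      A * (5 * p * e ^ 4)       ≡⟨ A*5pe⁴≡5pAe⁴ ⟩
      5 * p * A * e ^ 4         ≡⟨ eq ⟨
      C ^ 2 + A ^ 3             ∎)

  covering⁺ : ∀ {g d e M V} → Splitting g d → g ≢ 0 →
              5 * p * e ^ 4 + g * V ^ 2 ≡ (g * M ^ 2) ^ 2 → Covering g d M e V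
  covering⁺ {g} {d} {e} {M} {V} splitting g≢0 eq = *-cancelˡ-≡ _ _ g {{≢-nonZero g≢0}} (begin
    g * (V ^ 2 + d * e ^ 4)   ≡⟨ solve 4 (λ g V d e → g :* (V :^ 2 :+ d :* e :^ 4)
                                                   := g :* d :* e :^ 4 :+ g :* V :^ 2) refl g V d e ⟩
    g * d * e ^ 4 + g * V ^ 2 ≡⟨ cong (λ x → x * e ^ 4 + g * V ^ 2) (splitting-product splitting) ⟩
    5 * p * e ^ 4 + g * V ^ 2 ≡⟨ eq ⟩
    (g * M ^ 2) ^ 2           ≡⟨ solve 2 (λ g M → (g :* M :^ 2) :^ 2 := g :* (g :* M :^ 4)) refl g M ⟩
    g * (g * M ^ 4)           ∎)
    where open ≡-Reasoning

  covering⁻ : ∀ {g d e M V} → Splitting g d → g ≢ 0 →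
              (g * M ^ 2) ^ 2 + g * V ^ 2 ≡ 5 * p * e ^ 4 → Covering d g e M V
  covering⁻ {g} {d} {e} {M} {V} splitting g≢0 eq = *-cancelˡ-≡ _ _ g {{≢-nonZero g≢0}} (begin
    g * (V ^ 2 + g * M ^ 4)     ≡⟨ solve 3 (λ g V M → g :* (V :^ 2 :+ g :* M :^ 4)
                                                   := (g :* M :^ 2) :^ 2 :+ g :* V :^ 2) refl g V M ⟩
    (g * M ^ 2) ^ 2 + g * V ^ 2 ≡⟨ eq ⟩
    5 * p * e ^ 4               ≡⟨ cong (_* e ^ 4) (splitting-product splitting) ⟨
    g * d * e ^ 4               ≡⟨ *-assoc g d (e ^ 4) ⟩
    g * (d * e ^ 4)             ∎)
    where open ≡-Reasoning

  no-point⁺ : A ≢ 0 → e ≢ 0 → Coprime A e → C ^ 2 + 5 * p * A * e ^ 4 ≢ A ^ 3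
  no-point⁺ {A} {e} {C} A≢0 e≢0 A⊥e eq =
    case cofactor⁺ {A} {C} {e} A≢0 eq of λ where
      (K , 5pe⁴+K≡A² , AK≡C²) →
        case square-class {A} {e} {K} {C} A≢0 A⊥e AK≡C² (λ {g} g∣A g∣K →
               ∣m+n∣m⇒∣n (subst (g ∣_) (trans (sym 5pe⁴+K≡A²) (+-comm (5 * p * e ^ 4) K)) (∣⇒∣^ 2 g∣A))
                         g∣K) of λ where
          (g , d , splitting , M , V , A≡gM² , K≡gV² , M⊥e) →
            no-covering {g} {d} {e} {M} {V} splitting e≢0 M⊥e
              (covering⁺ {g} {d} {e} {M} {V} splitting (λ g≡0 → A≢0 (trans A≡gM² (cong (_* M ^ 2) g≡0)))
                (subst₂ (λ k a → 5 * p * e ^ 4 + k ≡ a ^ 2) K≡gV² A≡gM² 5pe⁴+K≡A²))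

  no-point⁻ : A ≢ 0 → Coprime A e → C ^ 2 + A ^ 3 ≢ 5 * p * A * e ^ 4
  no-point⁻ {A} {e} {C} A≢0 A⊥e eq =
    case cofactor⁻ {A} {C} {e} A≢0 eq of λ where
      (K , A²+K≡5pe⁴ , AK≡C²) →
        case square-class {A} {e} {K} {C} A≢0 A⊥e AK≡C² (λ {g} g∣A g∣K →
               subst (g ∣_) A²+K≡5pe⁴ (∣m∣n⇒∣m+n (∣⇒∣^ 2 g∣A) g∣K)) of λ where
          (g , d , splitting , M , V , A≡gM² , K≡gV² , M⊥e) →
            no-covering {d} {g} {M} {e} {V} (splitting-swap splitting)
              (λ M≡0 → A≢0 (trans A≡gM² (trans (cong (λ z → g * z ^ 2) M≡0) (*-zeroʳ g))))
              (Coprimality.sym M⊥e)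
              (covering⁻ {g} {d} {e} {M} {V} splitting (λ g≡0 → A≢0 (trans A≡gM² (cong (_* M ^ 2) g≡0)))
                (subst₂ (λ k a → a ^ 2 + k ≡ 5 * p * e ^ 4) K≡gV² A≡gM² A²+K≡5pe⁴))

  no-point-in-lowest-terms⁺ : A ≢ 0 → b ≢ 0 → Coprime A b → Coprime C d →
                              C ^ 2 * b ^ 3 + 5 * p * A * b ^ 2 * d ^ 2 ≢ A ^ 3 * d ^ 2
  no-point-in-lowest-terms⁺ {A} {b} {C} {d} A≢0 b≢0 A⊥b C⊥d eq =
    case square-cube-denominators {b = b} {a = A} {c = C} {d = d} (5 * p) b≢0 A⊥b C⊥d (inj₁ eq) of λ where
      (e , b≡e² , d≡e³) →
        let e≢0 = λ e≡0 → b≢0 (trans b≡e² (cong (_^ 2) e≡0))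
        in  no-point⁺ {A} {e} {C} A≢0 e≢0
              (coprime-∣ʳ (subst (e ∣_) (sym b≡e²) (∣⇒∣^ 2 ∣-refl)) A⊥b)
              (*-cancelʳ-≡ _ _ (e ^ 6) {{m^n≢0 e 6 {{≢-nonZero e≢0}}}} (begin
                (C ^ 2 + 5 * p * A * e ^ 4) * e ^ 6
                  ≡⟨ solve 4 (λ C p A e → (C :^ 2 :+ con 5 :* p :* A :* e :^ 4) :* e :^ 6
                                       := C :^ 2 :* (e :^ 2) :^ 3 :+ con 5 :* p :* A :* (e :^ 2) :^ 2 :* (e :^ 3) :^ 2)
                           refl C p A e ⟩
                C ^ 2 * (e ^ 2) ^ 3 + 5 * p * A * (e ^ 2) ^ 2 * (e ^ 3) ^ 2
                  ≡⟨ subst₂ (λ b d → C ^ 2 * b ^ 3 + 5 * p * A * b ^ 2 * d ^ 2 ≡ A ^ 3 * d ^ 2) b≡e² d≡e³ eq ⟩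
                A ^ 3 * (e ^ 3) ^ 2
                  ≡⟨ solve 2 (λ A e → A :^ 3 :* (e :^ 3) :^ 2 := A :^ 3 :* e :^ 6) refl A e ⟩
                A ^ 3 * e ^ 6 ∎))
    where open ≡-Reasoning

  no-point-in-lowest-terms⁻ : A ≢ 0 → b ≢ 0 → Coprime A b → Coprime C d →
                              C ^ 2 * b ^ 3 + A ^ 3 * d ^ 2 ≢ 5 * p * A * b ^ 2 * d ^ 2
  no-point-in-lowest-terms⁻ {A} {b} {C} {d} A≢0 b≢0 A⊥b C⊥d eq =
    case square-cube-denominators {b = b} {a = A} {c = C} {d = d} (5 * p) b≢0 A⊥b C⊥d (inj₂ eq) of λ where
      (e , b≡e² , d≡e³) →
        let e≢0 = λ e≡0 → b≢0 (trans b≡e² (cong (_^ 2) e≡0))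
        in  no-point⁻ {A} {e} {C} A≢0
              (coprime-∣ʳ (subst (e ∣_) (sym b≡e²) (∣⇒∣^ 2 ∣-refl)) A⊥b)
              (*-cancelʳ-≡ _ _ (e ^ 6) {{m^n≢0 e 6 {{≢-nonZero e≢0}}}} (begin
                (C ^ 2 + A ^ 3) * e ^ 6
                  ≡⟨ solve 3 (λ C A e → (C :^ 2 :+ A :^ 3) :* e :^ 6
                                     := C :^ 2 :* (e :^ 2) :^ 3 :+ A :^ 3 :* (e :^ 3) :^ 2) refl C A e ⟩
                C ^ 2 * (e ^ 2) ^ 3 + A ^ 3 * (e ^ 3) ^ 2
                  ≡⟨ subst₂ (λ b d → C ^ 2 * b ^ 3 + A ^ 3 * d ^ 2 ≡ 5 * p * A * b ^ 2 * d ^ 2) b≡e² d≡e³ eq ⟩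
                5 * p * A * (e ^ 2) ^ 2 * (e ^ 3) ^ 2
                  ≡⟨ solve 3 (λ p A e → con 5 :* p :* A :* (e :^ 2) :^ 2 :* (e :^ 3) :^ 2
                                     := con 5 :* p :* A :* e :^ 4 :* e :^ 6) refl p A e ⟩
                5 * p * A * e ^ 4 * e ^ 6 ∎))
    where open ≡-Reasoning

  affine-point⇒origin : ∀ {x y} → OnCurve p x y → x ≡ 0ℚ × y ≡ 0ℚ
  affine-point⇒origin {x@(mkℚ (+ zero) b-1 _)} {y@(mkℚ c d-1 _)} oc =
    ℚ.↥p≡0⇒p≡0 x refl , ℚ.↥p≡0⇒p≡0 y (ℤ.∣i∣≡0⇒i≡0 ∣c∣≡0)
    where
    c²b³≡0 : ∣ c ∣ ^ 2 * suc b-1 ^ 3 ≡ 0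
    c²b³≡0 = m+n≡0⇒m≡0 _ (curve-equation-ℕ⁺ (5 * p) 0 c (suc b-1) (suc d-1) (curve-equation-ℤ p x y oc))
    ∣c∣≡0 : ∣ c ∣ ≡ 0
    ∣c∣≡0 = m^n≡0⇒m≡0 ∣ c ∣ 2 (m*n≡0⇒m≡0 (∣ c ∣ ^ 2) (suc b-1 ^ 3) {{m^n≢0 (suc b-1) 3}} c²b³≡0)
  affine-point⇒origin {x@(mkℚ (+ suc A-1) b-1 A⊥b)} {y@(mkℚ c d-1 c⊥d)} oc =
    ⊥-elim (no-point-in-lowest-terms⁺ (λ ()) (λ ()) (Coprimality.recompute A⊥b) (Coprimality.recompute c⊥d)
      (curve-equation-ℕ⁺ (5 * p) (suc A-1) c (suc b-1) (suc d-1) (curve-equation-ℤ p x y oc)))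
  affine-point⇒origin {x@(mkℚ -[1+ A-1 ] b-1 A⊥b)} {y@(mkℚ c d-1 c⊥d)} oc =
    ⊥-elim (no-point-in-lowest-terms⁻ (λ ()) (λ ()) (Coprimality.recompute A⊥b) (Coprimality.recompute c⊥d)
      (curve-equation-ℕ⁻ (5 * p) (suc A-1) c (suc b-1) (suc d-1) (curve-equation-ℤ p x y oc)))

theorem1p1 : (p : ℕ) → Prime p → (p % 40 ≡ 7 ⊎ p % 40 ≡ 23) → FiniteMW p
theorem1p1 p p-prime p%40∈[7,23] = (0ℚ , 0ℚ) ∷ [] , λ x y oc →
  let x≡0 , y≡0 = affine-point⇒origin p p-prime p%8≡7 p%5∈[2,3] oc in here (cong₂ _,_ x≡0 y≡0)
  where
  p%8≡7 : p % 8 ≡ 7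
  p%8≡7 = trans (sym (m∣n⇒o%n%m≡o%m 8 40 p (divides 5 refl))) ([ cong (_% 8) , cong (_% 8) ]′ p%40∈[7,23])
  p%5∈[2,3] : p % 5 ∈ 2 ∷ 3 ∷ []
  p%5∈[2,3] = subst (_∈ 2 ∷ 3 ∷ []) (m∣n⇒o%n%m≡o%m 5 40 p (divides 8 refl))
    ([ (λ eq → here (cong (_% 5) eq)) , (λ eq → there (here (cong (_% 5) eq))) ]′ p%40∈[7,23])
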